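{- $\mathit{NOM}:\mathsf{PROP}\to\mathsf n\mathsf{PROP}$ is a functor, mapping an arrow of $\mathsf{PROP}$s $F:\mathcal S\to\mathcal S'$ to the arrow of nominal $\mathsf{PROP}$s $\mathit{NOM}(F):\mathit{NOM}(\mathcal S)\to\mathit{NOM}(\mathcal S')$ defined by $\mathit{NOM}(F)([\boldsymbol a\rangle g\langle\boldsymbol b])=[\boldsymbol a\rangle Fg\langle\boldsymbol b]$.
   Context: $\mathcal N$ is a countably infinite set of names. A $\mathsf{PROP}$ (MacLane) is a symmetric strict monoidal category with objects the natural numbers $\underline n$, tensor $\oplus$ given by addition on objects, composition $;$ (diagrammatic order), symmetries satisfying the symmetric strict monoidal laws including naturality of symmetries. $\mathsf{PROP}$ is the category of $\mathsf{PROP}$s with identity-on-objects strict symmetric monoidal functors. A nominal $\mathsf{PROP}$ is a small category with objects the finite subsets of $\mathcal N$, partial tensor $\uplus$ (union of disjoint sets; $f\uplus g$ defined iff domains disjoint and codomains disjoint), commutative and associative with unit $\emptyset$, satisfying identity/associativity and interchange $(s;t)\uplus(u;v)=(s\uplus u);(t\uplus v)$ whenever both sides are defined, containing all bijections $\pi_A:A\to\pi[A]$ for finite permutations $\pi$, with permutation action on arrows $\pi\cdot f=(\pi_A)^{ -1};f;\pi_B$. $\mathsf n\mathsf{PROP}$ is the category of nominal $\mathsf{PROP}$s with identity-on-objects, strict monoidal, equivariant functors. For a $\mathsf{PROP}$ $\mathcal S$, $\mathit{NOM}(\mathcal S)$ is the nominal $\mathsf{PROP}$ with arrows $[\boldsymbol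 a\rangle f\langle\boldsymbol b]:\underline{\boldsymbol a}\to\underline{\boldsymbol b}$ for $f:\underline n\to\underline m$ in $\mathcal S$ and lists $\boldsymbol a,\boldsymbol b$ of pairwise distinct names of lengths $n,m$ ($\underline{\boldsymbol a}$ the set of entries), subject to: $[\boldsymbol a\rangle f;g\langle\boldsymbol c]=[\boldsymbol a\rangle f\langle\boldsymbol b];[\boldsymbol b\rangle g\langle\boldsymbol c]$; $[\boldsymbol a+\boldsymbol c\rangle f\oplus g\langle\boldsymbol b+\boldsymbol d]=[\boldsymbol a\rangle f\langle\boldsymbol b]\uplus[\boldsymbol c\rangle g\langle\boldsymbol d]$; $[\boldsymbol a\rangle\mathit{id}\langle\boldsymbol b]=[\boldsymbol a|\boldsymbol b]$; $[\boldsymbol a\rangle\langle\boldsymbol b|\boldsymbol b'\rangle;f\langle\boldsymbol c]=[\boldsymbol a|\boldsymbol b];[\boldsymbol b'\rangle f\langle\boldsymbol c]$; $[\boldsymbol a\rangle f;\langle\boldsymbol b|\boldsymbol b'\rangle\langle\boldsymbol c]=[\boldsymbol a\rangle f\langle\boldsymbol b];[\boldsymbol b'|\boldsymbol c]$. Here $+$ is list concatenation, $\langle\boldsymbol a|\boldsymbol a'\rangle$ is the symmetry of a $\mathsf{PROP}$ mapping $i\mapsto j$ where $a_i=a'_j$, and $[\boldsymbol a|\boldsymbol b]=\biguplus_i\delta_{a_ib_i}$ with $\delta_{ab}:\{a\}\to\{b\}$ the bijection. -}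

module Defs where

open import Level using (0ℓ)
open import Data.Nat using (ℕ; zero; suc; _+_; compare; less; equal; greater)
open import Data.Nat.Properties using (+-assoc; +-identityʳ)
open import Data.List using (List; []; _∷_; _++_; length; map; foldr)
open import Data.List.Properties using (length-++)
open import Data.List.Membership.Propositional using (_∈_; _∉_)
open import Data.List.Relation.Unary.Any using (here)
open import Data.List.Relation.Unary.Unique.Propositional using (Unique)
open import Data.List.Relation.Binary.Permutation.Propositional using (_↭_; refl; prep; swap; trans)
open import Data.Product using (_×_; _,_)
import Data.Product as Prod
open import Data.Empty using (⊥)
open import Function using (_∘_; const)
import Function as Fun
open import Relation.Binary using (Rel; IsEquivalence)
open import Relation.Binary.PropositionalEquality
  using (_≡_; subst; subst₂; sym) renaming (refl to ≡-refl)

Name : Set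
Name = ℕ

-- Finite subsets of 𝒩, in a canonical ("gap") encoding, so that equal
-- sets are propositionally equal:
--   []      encodes ∅
--   g ∷ s   encodes {g} ∪ { g + 1 + x ∣ x ∈ s }
FinSet : Set
FinSet = List ℕ

elems : FinSet → List Name
elems []      = []
elems (g ∷ s) = g ∷ map (λ y → suc (g + y)) (elems s)

_∈ˢ_ : Name → FinSet → Set
x ∈ˢ A = x ∈ elems A

∅ : FinSet
∅ = []

insert : Name → FinSet → FinSet
insert x []      = x ∷ []
insert x (g ∷ s) with compare x g
... | less _ k    = x ∷ k ∷ s
... | equal _     = g ∷ s
... | greater _ k = g ∷ insert k s

setOf : List Name → FinSet
setOf = foldr insert ∅

_∪_ : FinSet → FinSet → FinSet
A ∪ B = foldr insert B (elems A)

Disjoint : FinSet → FinSet → Set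
Disjoint A B = ∀ x → x ∈ˢ A → x ∈ˢ B → ⊥

IsBij : FinSet → FinSet → (ℕ → ℕ) → (ℕ → ℕ) → Set
IsBij A B σ τ =
  (∀ x → x ∈ˢ A → (σ x ∈ˢ B) × (τ (σ x) ≡ x)) ×
  (∀ y → y ∈ˢ B → (τ y ∈ˢ A) × (σ (τ y) ≡ y))

IsBij-inv : ∀ {A B σ τ} → IsBij A B σ τ → IsBij B A τ σ
IsBij-inv = Prod.swap

record FinPerm : Set where
  field
    to      : Name → Name
    from    : Name → Name
    from-to : ∀ x → from (to x) ≡ x
    to-from : ∀ x → to (from x) ≡ x
    support : List Name
    finite  : ∀ x → x ∉ support → to x ≡ x

record PROP : Set₁ where
  infixr 9 _⨾_
  infixr 10 _⊕_
  infix 4 _≈_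
  field
    Hom   : ℕ → ℕ → Set
    _≈_   : ∀ {n m} → Rel (Hom n m) 0ℓ
    isEquivalence : ∀ {n m} → IsEquivalence (_≈_ {n} {m})
    id    : ∀ {n} → Hom n n
    _⨾_   : ∀ {n m k} → Hom n m → Hom m k → Hom n k
    _⊕_   : ∀ {n m k l} → Hom n m → Hom k l → Hom (n + k) (m + l)
    σ     : ∀ n m → Hom (n + m) (m + n)
    ⨾-cong  : ∀ {n m k} {f f' : Hom n m} {g g' : Hom m k} →
              f ≈ f' → g ≈ g' → f ⨾ g ≈ f' ⨾ g'
    ⨾-assoc : ∀ {n m k l} (f : Hom n m) (g : Hom m k) (h : Hom k l) →
              (f ⨾ g) ⨾ h ≈ f ⨾ (g ⨾ h)
    ⨾-idˡ   : ∀ {n m} (f : Hom n m) → id ⨾ f ≈ f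
    ⨾-idʳ   : ∀ {n m} (f : Hom n m) → f ⨾ id ≈ f
    ⊕-cong  : ∀ {n m k l} {f f' : Hom n m} {g g' : Hom k l} →
              f ≈ f' → g ≈ g' → f ⊕ g ≈ f' ⊕ g'
    ⊕-id    : ∀ n m → id {n} ⊕ id {m} ≈ id {n + m}
    interchange : ∀ {n m k n' m' k'} (f : Hom n m) (g : Hom m k)
                    (f' : Hom n' m') (g' : Hom m' k') →
                  (f ⨾ g) ⊕ (f' ⨾ g') ≈ (f ⊕ f') ⨾ (g ⊕ g')
    ⊕-assoc : ∀ {n m k l p q} (f : Hom n m) (g : Hom k l) (h : Hom p q) →
              subst₂ Hom (+-assoc n k p) (+-assoc m l q) ((f ⊕ g) ⊕ h)
                ≈ f ⊕ (g ⊕ h)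
    ⊕-unitˡ : ∀ {n m} (f : Hom n m) → id {0} ⊕ f ≈ f
    ⊕-unitʳ : ∀ {n m} (f : Hom n m) →
              subst₂ Hom (+-identityʳ n) (+-identityʳ m) (f ⊕ id {0}) ≈ f
    σ-natural : ∀ {n m k l} (f : Hom n m) (g : Hom k l) →
                (f ⊕ g) ⨾ σ m l ≈ σ n k ⨾ (g ⊕ f)
    σ-inv     : ∀ n m → σ n m ⨾ σ m n ≈ id
    σ-unit    : ∀ n → subst₂ Hom (+-identityʳ n) ≡-refl (σ n 0) ≈ id
    σ-hexagon : ∀ n m k →
                σ n (m + k) ≈
                subst₂ Hom ≡-refl (sym (+-assoc m k n))
                  (subst₂ Hom (+-assoc n m k) (+-assoc m n k) (σ n m ⊕ id {k})
                   ⨾ (id {m} ⊕ σ n k))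

record PROPHom (S T : PROP) : Set where
  private
    module S = PROP S
    module T = PROP T
  field
    F      : ∀ {n m} → S.Hom n m → T.Hom n m
    F-cong : ∀ {n m} {f g : S.Hom n m} → f S.≈ g → F f T.≈ F g
    F-id   : ∀ {n} → F (S.id {n}) T.≈ T.id
    F-⨾    : ∀ {n m k} (f : S.Hom n m) (g : S.Hom m k) → F (f S.⨾ g) T.≈ F f T.⨾ F g
    F-⊕    : ∀ {n m k l} (f : S.Hom n m) (g : S.Hom k l) → F (f S.⊕ g) T.≈ F f T.⊕ F g
    F-σ    : ∀ n m → F (S.σ n m) T.≈ T.σ n m

idPROPHom : (S : PROP) → PROPHom S S
idPROPHom S = record
  { F = Fun.id ; F-cong = Fun.id ; F-id = r ; F-⨾ = λ _ _ → r ; F-⊕ = λ _ _ → r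
  ; F-σ = λ _ _ → r }
  where
  open PROP S
  r : ∀ {n m} {f : Hom n m} → f ≈ f
  r = IsEquivalence.refl isEquivalence

_∘P_ : ∀ {S T U} → PROPHom T U → PROPHom S T → PROPHom S U
_∘P_ {S} {T} {U} G F = record
  { F = G.F ∘ F.F
  ; F-cong = G.F-cong ∘ F.F-cong
  ; F-id = tr (G.F-cong F.F-id) G.F-id
  ; F-⨾ = λ f g → tr (G.F-cong (F.F-⨾ f g)) (G.F-⨾ (F.F f) (F.F g))
  ; F-⊕ = λ f g → tr (G.F-cong (F.F-⊕ f g)) (G.F-⊕ (F.F f) (F.F g))
  ; F-σ = λ n m → tr (G.F-cong (F.F-σ n m)) (G.F-σ n m) }
  where
  module G = PROPHom G
  module F = PROPHom F
  open PROP U using (_≈_; isEquivalence)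
  tr : ∀ {n m} {x y z : PROP.Hom U n m} → x ≈ y → y ≈ z → x ≈ z
  tr = IsEquivalence.trans isEquivalence

-- The symmetry ⟨ b ∣ b' ⟩ of a PROP, for b' a permutation of b
-- (position i of b is wired to the position j of b' with b_i = b'_j).
-- It is built from the given witness p : b ↭ b'; for lists of pairwise
-- distinct names, all witnesses give ≈-equal arrows (coherence).
symm : (S : PROP) {b b' : List Name} → b ↭ b' → PROP.Hom S (length b) (length b')
symm S refl          = PROP.id S
symm S (prep x p)    = PROP._⊕_ S (PROP.id S {1}) (symm S p)
symm S (swap x y p)  = PROP._⊕_ S (PROP.σ S 1 1) (symm S p)
symm S (trans p q)   = PROP._⨾_ S (symm S p) (symm S q)

record NomPROPStr : Set₁ where
  infixr 9 _⨾_
  infix 4 _≈_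
  field
    Hom    : FinSet → FinSet → Set
    _≈_    : ∀ {A B} → Rel (Hom A B) 0ℓ
    id     : ∀ {A} → Hom A A
    _⨾_    : ∀ {A B C} → Hom A B → Hom B C → Hom A C
    tensor : ∀ {A B C D} → Hom A B → Hom C D →
             .(Disjoint A C) → .(Disjoint B D) → Hom (A ∪ C) (B ∪ D)
    bij    : (A B : FinSet) (σ τ : ℕ → ℕ) → .(IsBij A B σ τ) → Hom A B

  -- permutation action π · f = (π_A)⁻¹ ; f ; π_B, where A' = π[A], B' = π[B]
  -- (A' = π[A] iff IsBij A A' (to π) (from π))
  act : (π : FinPerm) {A B A' B' : FinSet} →
        IsBij A A' (FinPerm.to π) (FinPerm.from π) →
        IsBij B B' (FinPerm.to π) (FinPerm.from π) →
        Hom A B → Hom A' B'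
  act π {A} {B} {A'} {B'} p q f =
    bij A' A (FinPerm.from π) (FinPerm.to π) (IsBij-inv p) ⨾ f ⨾
    bij B B' (FinPerm.to π) (FinPerm.from π) q

record IsNomPROPHom (P Q : NomPROPStr)
       (Φ : ∀ {A B} → NomPROPStr.Hom P A B → NomPROPStr.Hom Q A B) : Set where
  private
    module P = NomPROPStr P
    module Q = NomPROPStr Q
  field
    Φ-cong   : ∀ {A B} {f g : P.Hom A B} → f P.≈ g → Φ f Q.≈ Φ g
    Φ-id     : ∀ {A} → Φ (P.id {A}) Q.≈ Q.id
    Φ-⨾      : ∀ {A B C} (f : P.Hom A B) (g : P.Hom B C) → Φ (f P.⨾ g) Q.≈ Φ f Q.⨾ Φ g
    Φ-tensor : ∀ {A B C D} (f : P.Hom A B) (g : P.Hom C D)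
               .(d : Disjoint A C) .(e : Disjoint B D) →
               Φ (P.tensor f g d e) Q.≈ Q.tensor (Φ f) (Φ g) d e
    Φ-equivariant : ∀ (π : FinPerm) {A B A' B'}
                    (p : IsBij A A' (FinPerm.to π) (FinPerm.from π))
                    (q : IsBij B B' (FinPerm.to π) (FinPerm.from π))
                    (f : P.Hom A B) →
                    Φ (P.act π p q f) Q.≈ Q.act π p q (Φ f)

-- NOM(S): the nominal PROP presented by generators [a⟩ f ⟨b] and relations

module NOMConstruction (S : PROP) where
  private module S = PROP S

  data Tm : FinSet → FinSet → Set where
    gen     : (a b : List Name) → .(Unique a) → .(Unique b) →
              S.Hom (length a) (length b) → Tm (setOf a) (setOf b)
    idₜ     : ∀ {A} → Tm A A
    _⨾ₜ_    : ∀ {A B C} → Tm A B → Tm B C → Tm A C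
    tensorₜ : ∀ {A B C D} → Tm A B → Tm C D →
              .(Disjoint A C) → .(Disjoint B D) → Tm (A ∪ C) (B ∪ D)
    bijₜ    : (A B : FinSet) (σ τ : ℕ → ℕ) → .(IsBij A B σ τ) → Tm A B

  δ : (x y : Name) → Tm (x ∷ []) (y ∷ [])
  δ x y = bijₜ (x ∷ []) (y ∷ []) (const y) (const x)
            ((λ { _ (here ≡-refl) → here ≡-refl , ≡-refl })
            , (λ { _ (here ≡-refl) → here ≡-refl , ≡-refl }))

  data Pairing : {A B : FinSet} → List Name → List Name → Tm A B → Set where
    pair-[] : Pairing [] [] (idₜ {∅})
    pair-∷  : ∀ {x y a b A B} {t : Tm A B} .{d e} → Pairing a b t →
              Pairing (x ∷ a) (y ∷ b) (tensorₜ (δ x y) t d e)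

  infix 4 _~_
  -- the congruence: nominal PROP laws + the defining relations of NOM(S)
  -- (heterogeneous in the objects, so that laws such as commutativity of ⊎
  --  need no transport; it is used homogeneously below)
  data _~_ : ∀ {A B A' B'} → Tm A B → Tm A' B' → Set where
    ~refl  : ∀ {A B} {t : Tm A B} → t ~ t
    ~sym   : ∀ {A B A' B'} {t : Tm A B} {u : Tm A' B'} → t ~ u → u ~ t
    ~trans : ∀ {A B A' B' A'' B''} {t : Tm A B} {u : Tm A' B'} {v : Tm A'' B''} →
             t ~ u → u ~ v → t ~ v
    ⨾-cong : ∀ {A B C A' B' C'} {f : Tm A B} {g : Tm B C} {f' : Tm A' B'} {g' : Tm B' C'} →
             f ~ f' → g ~ g' → (f ⨾ₜ g) ~ (f' ⨾ₜ g')
    tensor-cong : ∀ {A B C D A' B' C' D'} {f : Tm A B} {g : Tm C D}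
                    {f' : Tm A' B'} {g' : Tm C' D'} .{d e d' e'} →
                  f ~ f' → g ~ g' → tensorₜ f g d e ~ tensorₜ f' g' d' e'
    gen-cong : ∀ {a b} .{ua ub} {f g : S.Hom (length a) (length b)} → f S.≈ g →
               gen a b ua ub f ~ gen a b ua ub g
    ⨾-assoc : ∀ {A B C D} (f : Tm A B) (g : Tm B C) (h : Tm C D) →
              ((f ⨾ₜ g) ⨾ₜ h) ~ (f ⨾ₜ (g ⨾ₜ h))
    ⨾-idˡ   : ∀ {A B} (f : Tm A B) → (idₜ ⨾ₜ f) ~ f
    ⨾-idʳ   : ∀ {A B} (f : Tm A B) → (f ⨾ₜ idₜ) ~ f
    ⊎-comm  : ∀ {A B C D} (f : Tm A B) (g : Tm C D) .{d e d' e'} →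
              tensorₜ f g d e ~ tensorₜ g f d' e'
    ⊎-assoc : ∀ {A B C D E G} (f : Tm A B) (g : Tm C D) (h : Tm E G) .{d₁ e₁ d₂ e₂ d₃ e₃ d₄ e₄} →
              tensorₜ (tensorₜ f g d₁ e₁) h d₂ e₂ ~ tensorₜ f (tensorₜ g h d₃ e₃) d₄ e₄
    ⊎-unit  : ∀ {A B} (f : Tm A B) .{d e} → tensorₜ f (idₜ {∅}) d e ~ f
    interchange : ∀ {A B C A' B' C'} (s : Tm A B) (t : Tm B C) (u : Tm A' B') (v : Tm B' C')
                  .{d₁ d₂ d₃} →
                  tensorₜ (s ⨾ₜ t) (u ⨾ₜ v) d₁ d₂ ~ (tensorₜ s u d₁ d₃ ⨾ₜ tensorₜ t v d₃ d₂)
    -- the bijections form a subcategory compatible with ⊎,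
    -- and π_A only depends on π restricted to A
    bij-ext : ∀ {A B σ τ σ' τ'} .{p p'} →
              (∀ x → x ∈ˢ A → σ x ≡ σ' x) → (∀ y → y ∈ˢ B → τ y ≡ τ' y) →
              bijₜ A B σ τ p ~ bijₜ A B σ' τ' p'
    bij-id  : ∀ {A} .{p} → bijₜ A A Fun.id Fun.id p ~ idₜ {A}
    bij-⨾   : ∀ {A B C σ τ σ' τ'} .{p q r} →
              (bijₜ A B σ τ p ⨾ₜ bijₜ B C σ' τ' q) ~ bijₜ A C (σ' ∘ σ) (τ ∘ τ') r
    bij-⊎   : ∀ {A B C D σ τ} .{p q r d e} →
              tensorₜ (bijₜ A B σ τ p) (bijₜ C D σ τ q) d e ~ bijₜ (A ∪ C) (B ∪ D) σ τ r
    rel-⨾   : ∀ {a b c} .{ua ub uc} (f : S.Hom (length a) (length b))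
                (g : S.Hom (length b) (length c)) →
              gen a c ua uc (f S.⨾ g) ~ (gen a b ua ub f ⨾ₜ gen b c ub uc g)
    rel-⊕   : ∀ {a b c d} .{uac ubd ua ub uc ud dis₁ dis₂}
                (f : S.Hom (length a) (length b)) (g : S.Hom (length c) (length d)) →
              gen (a ++ c) (b ++ d) uac ubd
                (subst₂ S.Hom (sym (length-++ a)) (sym (length-++ b)) (f S.⊕ g))
              ~ tensorₜ (gen a b ua ub f) (gen c d uc ud g) dis₁ dis₂
    rel-id  : ∀ {a b} .{ua ub} {t : Tm (setOf a) (setOf b)} (e : length a ≡ length b) →
              Pairing a b t →
              gen a b ua ub (subst (S.Hom (length a)) e S.id) ~ t
    rel-symˡ : ∀ {a b b' c} .{ua ub' uc} {t : Tm (setOf a) (setOf b)}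
                 (p : b ↭ b') (f : S.Hom (length b') (length c)) (e : length b ≡ length a)
                 (e' : setOf b ≡ setOf b') →
               Pairing a b t →
               gen a c ua uc (subst (λ n → S.Hom n (length c)) e (symm S p S.⨾ f))
               ~ (subst (Tm (setOf a)) e' t ⨾ₜ gen b' c ub' uc f)
    rel-symʳ : ∀ {a b b' c} .{ua ub uc} {t : Tm (setOf b') (setOf c)}
                 (f : S.Hom (length a) (length b)) (p : b ↭ b') (e : length b' ≡ length c)
                 (e' : setOf b' ≡ setOf b) →
               Pairing b' c t →
               gen a c ua uc (subst (S.Hom (length a)) e (f S.⨾ symm S p))
               ~ (gen a b ua ub f ⨾ₜ subst (λ X → Tm X (setOf c)) e' t)

NOM : PROP → NomPROPStr
NOM S = record
  { Hom = Tm ; _≈_ = _~_ ; id = idₜ ; _⨾_ = _⨾ₜ_ ; tensor = tensorₜ ; bij = bijₜ }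
  where open NOMConstruction S

NOMmap : ∀ {S T} → PROPHom S T → ∀ {A B} →
         NOMConstruction.Tm S A B → NOMConstruction.Tm T A B
NOMmap F (NOMConstruction.gen a b ua ub g) = NOMConstruction.gen a b ua ub (PROPHom.F F g)
NOMmap F NOMConstruction.idₜ = NOMConstruction.idₜ
NOMmap F (t NOMConstruction.⨾ₜ u) = NOMmap F t NOMConstruction.⨾ₜ NOMmap F u
NOMmap F (NOMConstruction.tensorₜ t u d e) = NOMConstruction.tensorₜ (NOMmap F t) (NOMmap F u) d e
NOMmap F (NOMConstruction.bijₜ A B σ τ p) = NOMConstruction.bijₜ A B σ τ p

-- NOM(F) is defined term by term, so it preserves identities, composition, the partial
-- tensor and the bijections on the nose; equivariance then holds trivially, because the
-- permutation action is built from composition and bijections. The real content is that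
-- NOM(F) respects the congruence: F sends each defining relation of NOM(S) to an instance
-- of the same relation of NOM(T). For the relations involving symmetries ⟨b|b'⟩ this needs
-- F ⟨b|b'⟩ ≈ ⟨b|b'⟩, which holds since F preserves identities, ⊕, ⨾ and σ.
module Submission where

open import Defs
open import Data.Product using (_×_; _,_)
open import Data.List using (List)
open import Data.Nat using (ℕ)
open import Relation.Binary using (IsEquivalence)
open import Relation.Binary.PropositionalEquality
  using (_≡_; subst; subst₂) renaming (refl to ≡-refl; sym to ≡-sym)
open import Data.List.Relation.Binary.Permutation.Propositional
  using (_↭_; refl; prep; swap; trans)

module PROPHomProperties {S T : PROP} (Φ : PROPHom S T) where
  private
    module S = PROP S
    module T = PROP T
    ≈-trans : ∀ {n m} {x y z : T.Hom n m} → x T.≈ y → y T.≈ z → x T.≈ z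
    ≈-trans = IsEquivalence.trans T.isEquivalence
  open PROPHom Φ

  F-subst₂ : ∀ {n n' m m'} (p : n ≡ n') (q : m ≡ m') {x : S.Hom n m} {y : T.Hom n m} →
             F x T.≈ y → F (subst₂ S.Hom p q x) T.≈ subst₂ T.Hom p q y
  F-subst₂ ≡-refl ≡-refl e = e

  F-substˡ : ∀ {n n' m} (p : n ≡ n') {x : S.Hom n m} {y : T.Hom n m} →
             F x T.≈ y → F (subst (λ k → S.Hom k m) p x) T.≈ subst (λ k → T.Hom k m) p y
  F-substˡ ≡-refl e = e

  F-substʳ : ∀ {n m m'} (q : m ≡ m') {x : S.Hom n m} {y : T.Hom n m} →
             F x T.≈ y → F (subst (S.Hom n) q x) T.≈ subst (T.Hom n) q y
  F-substʳ ≡-refl e = e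

  F-symm : ∀ {b b' : List ℕ} (p : b ↭ b') → F (symm S p) T.≈ symm T p
  F-symm refl         = F-id
  F-symm (prep x p)   = ≈-trans (F-⊕ _ _) (T.⊕-cong F-id (F-symm p))
  F-symm (swap x y p) = ≈-trans (F-⊕ _ _) (T.⊕-cong (F-σ 1 1) (F-symm p))
  F-symm (trans p q)  = ≈-trans (F-⨾ _ _) (T.⨾-cong (F-symm p) (F-symm q))

module NOMmapProperties {S T : PROP} (Φ : PROPHom S T) where
  private
    module S = PROP S
    module T = PROP T
    module NS = NOMConstruction S
    ≈-refl : ∀ {n m} {x : T.Hom n m} → x T.≈ x
    ≈-refl = IsEquivalence.refl T.isEquivalence
    ≈-trans : ∀ {n m} {x y z : T.Hom n m} → x T.≈ y → y T.≈ z → x T.≈ z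
    ≈-trans = IsEquivalence.trans T.isEquivalence
  open PROPHom Φ
  open PROPHomProperties Φ
  open NOMConstruction T

  NOMmap-Pairing : ∀ {A B a b} {t : NS.Tm A B} → NS.Pairing a b t → Pairing a b (NOMmap Φ t)
  NOMmap-Pairing NS.pair-[]     = pair-[]
  NOMmap-Pairing (NS.pair-∷ p) = pair-∷ (NOMmap-Pairing p)

  NOMmap-substˡ : ∀ {A A' B} (e : A ≡ A') (t : NS.Tm A B) →
                  NOMmap Φ (subst (λ X → NS.Tm X B) e t) ≡ subst (λ X → Tm X B) e (NOMmap Φ t)
  NOMmap-substˡ ≡-refl t = ≡-refl

  NOMmap-substʳ : ∀ {A B B'} (e : B ≡ B') (t : NS.Tm A B) →
                  NOMmap Φ (subst (NS.Tm A) e t) ≡ subst (Tm A) e (NOMmap Φ t)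
  NOMmap-substʳ ≡-refl t = ≡-refl

  ≡⇒~ : ∀ {A B} {t u : Tm A B} → t ≡ u → t ~ u
  ≡⇒~ ≡-refl = ~refl

  NOMmap-cong : ∀ {A B A' B'} {t : NS.Tm A B} {u : NS.Tm A' B'} →
                t NS.~ u → NOMmap Φ t ~ NOMmap Φ u
  NOMmap-cong NS.~refl                  = ~refl
  NOMmap-cong (NS.~sym e)               = ~sym (NOMmap-cong e)
  NOMmap-cong (NS.~trans e e')          = ~trans (NOMmap-cong e) (NOMmap-cong e')
  NOMmap-cong (NS.⨾-cong e e')          = ⨾-cong (NOMmap-cong e) (NOMmap-cong e')
  NOMmap-cong (NS.tensor-cong e e')     = tensor-cong (NOMmap-cong e) (NOMmap-cong e')
  NOMmap-cong (NS.gen-cong e)           = gen-cong (F-cong e)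
  NOMmap-cong (NS.⨾-assoc f g h)        = ⨾-assoc _ _ _
  NOMmap-cong (NS.⨾-idˡ f)              = ⨾-idˡ _
  NOMmap-cong (NS.⨾-idʳ f)              = ⨾-idʳ _
  NOMmap-cong (NS.⊎-comm f g)           = ⊎-comm _ _
  NOMmap-cong (NS.⊎-assoc f g h)        = ⊎-assoc _ _ _
  NOMmap-cong (NS.⊎-unit f)             = ⊎-unit _
  NOMmap-cong (NS.interchange s t u v)  = interchange _ _ _ _
  NOMmap-cong (NS.bij-ext eσ eτ)        = bij-ext eσ eτ
  NOMmap-cong NS.bij-id                 = bij-id
  NOMmap-cong NS.bij-⨾                  = bij-⨾
  NOMmap-cong NS.bij-⊎                  = bij-⊎
  NOMmap-cong (NS.rel-⨾ f g)            = ~trans (gen-cong (F-⨾ f g)) (rel-⨾ _ _)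
  NOMmap-cong (NS.rel-⊕ {a} {b} {c} {d} f g) =
    ~trans (gen-cong (F-subst₂ _ _ (F-⊕ f g))) (rel-⊕ {a = a} {b} {c} {d} _ _)
  NOMmap-cong (NS.rel-id e p) =
    ~trans (gen-cong (F-substʳ e F-id)) (rel-id e (NOMmap-Pairing p))
  NOMmap-cong (NS.rel-symˡ {t = t} p f e e' pairing) =
    ~trans (gen-cong (F-substˡ e (≈-trans (F-⨾ _ _) (T.⨾-cong (F-symm p) ≈-refl))))
      (~trans (rel-symˡ p (F f) e e' (NOMmap-Pairing pairing))
              (⨾-cong (≡⇒~ (≡-sym (NOMmap-substʳ e' t))) ~refl))
  NOMmap-cong (NS.rel-symʳ {t = t} f p e e' pairing) =
    ~trans (gen-cong (F-substʳ e (≈-trans (F-⨾ _ _) (T.⨾-cong ≈-refl (F-symm p)))))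
      (~trans (rel-symʳ (F f) p e e' (NOMmap-Pairing pairing))
              (⨾-cong ~refl (≡⇒~ (≡-sym (NOMmap-substˡ e' t)))))

  NOMmap-isNomPROPHom : IsNomPROPHom (NOM S) (NOM T) (NOMmap Φ)
  NOMmap-isNomPROPHom = record
    { Φ-cong        = NOMmap-cong
    ; Φ-id          = ~refl
    ; Φ-⨾           = λ _ _ → ~refl
    ; Φ-tensor      = λ _ _ _ _ → ~refl
    ; Φ-equivariant = λ _ _ _ _ → ~refl
    }

module _ (S : PROP) where
  open NOMConstruction S

  NOMmap-identity : ∀ {A B} (t : Tm A B) → NOMmap (idPROPHom S) t ~ t
  NOMmap-identity (gen a b ua ub f)   = ~refl
  NOMmap-identity idₜ                 = ~refl
  NOMmap-identity (t ⨾ₜ u)            = ⨾-cong (NOMmap-identity t) (NOMmap-identity u)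
  NOMmap-identity (tensorₜ t u d e)   = tensor-cong (NOMmap-identity t) (NOMmap-identity u)
  NOMmap-identity (bijₜ A B σ τ p)    = ~refl

module _ {S T U : PROP} (G : PROPHom T U) (F : PROPHom S T) where
  open NOMConstruction U using (_~_; ~refl; ⨾-cong; tensor-cong)
  open NOMConstruction S using (Tm; gen; idₜ; _⨾ₜ_; tensorₜ; bijₜ)

  NOMmap-∘ : ∀ {A B} (t : Tm A B) → NOMmap (G ∘P F) t ~ NOMmap G (NOMmap F t)
  NOMmap-∘ (gen a b ua ub f)   = ~refl
  NOMmap-∘ idₜ                 = ~refl
  NOMmap-∘ (t ⨾ₜ u)            = ⨾-cong (NOMmap-∘ t) (NOMmap-∘ u)
  NOMmap-∘ (tensorₜ t u d e)   = tensor-cong (NOMmap-∘ t) (NOMmap-∘ u)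
  NOMmap-∘ (bijₜ A B σ τ p)    = ~refl

mainTheorem11 : (S T : PROP) (F : PROPHom S T) →
    IsNomPROPHom (NOM S) (NOM T) (NOMmap F)
    × (∀ {A B} (t : NomPROPStr.Hom (NOM S) A B) →
         NomPROPStr._≈_ (NOM S) (NOMmap (idPROPHom S) t) t)
    × (∀ (U : PROP) (G : PROPHom T U) {A B} (t : NomPROPStr.Hom (NOM S) A B) →
         NomPROPStr._≈_ (NOM U) (NOMmap (G ∘P F) t) (NOMmap G (NOMmap F t)))
mainTheorem11 S T F =
  NOMmapProperties.NOMmap-isNomPROPHom F , NOMmap-identity S , λ U G → NOMmap-∘ G F
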